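{- (i) For all strictly positive formulas $\varphi,\psi$: if $\mathscr{T}(\varphi)\hookrightarrow^{*}\mathscr{T}(\psi)$ then $\varphi\vdash_{\mathbf{RC}}\psi$. (ii) For all modal trees $\mathtt{T},\mathtt{T}'$: if $\mathscr{F}(\mathtt{T})\vdash_{\mathbf{RC}}\mathscr{F}(\mathtt{T}')$ then $\mathtt{T}\hookrightarrow^{*}\mathtt{T}'$.
   Context: Strictly positive formulas $\mathcal{L}^+$: $\varphi::=\top\mid p\mid\langle\alpha\rangle\varphi\mid(\varphi\wedge\varphi)$ with $p$ a propositional variable and $\alpha<\omega$. $\mathbf{K}^+$ has axioms $\varphi\vdash\varphi$, $\varphi\vdash\top$, $\varphi\wedge\psi\vdash\varphi$, $\varphi\wedge\psi\vdash\psi$, and rules: from $\varphi\vdash\psi$ and $\psi\vdash\chi$ infer $\varphi\vdash\chi$; from $\varphi\vdash\psi$ and $\varphi\vdash\chi$ infer $\varphi\vdash\psi\wedge\chi$; from $\varphi\vdash\psi$ infer $\langle\alpha\rangle\varphi\vdash\langle\alpha\rangle\psi$. $\mathbf{RC}$ extends $\mathbf{K}^+$ by axioms $\langle\alpha\rangle\langle\alpha\rangle\varphi\vdash\langle\alpha\rangle\varphi$; $\langle\alpha\rangle\varphi\vdash\langle\beta\rangle\varphi$ for $\alpha>\beta$; $\langle\alpha\rangle\varphi\wedge\langle\beta\rangle\psi\vdash\langle\alpha\rangle(\varphi\wedge\langle\beta\rangle\psi)$ for $\alpha>\beta$. Modal trees: recursively, pairs $\langle\Delta;\Gamma\rangle$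 with $\Delta$ a finite list of propositional variables and $\Gamma$ a finite list of pairs $(\alpha,\mathtt{S})$, $\alpha<\omega$, $\mathtt{S}$ a modal tree. Sum: $\langle\Delta_1;\Gamma_1\rangle+\langle\Delta_2;\Gamma_2\rangle=\langle\Delta_1\frown\Delta_2;\Gamma_1\frown\Gamma_2\rangle$. $\mathscr{T}(\top)=\langle\varnothing;\varnothing\rangle$, $\mathscr{T}(p)=\langle[p];\varnothing\rangle$, $\mathscr{T}(\langle\alpha\rangle\varphi)=\langle\varnothing;[(\alpha,\mathscr{T}(\varphi))]\rangle$, $\mathscr{T}(\varphi\wedge\psi)=\mathscr{T}(\varphi)+\mathscr{T}(\psi)$. $\bigwedge\varnothing=\top$, $\bigwedge(\varphi\frown\Pi)=\varphi\wedge\bigwedge\Pi$; $\mathscr{F}(\langle\Delta;\Gamma\rangle):=\bigwedge\Delta\wedge\bigwedge[\langle\alpha\rangle\mathscr{F}(\mathtt{S})\mid(\alpha,\mathtt{S})\in\Gamma]$. Positions: $\mathrm{Pos}(\langle\Delta;\varnothing\rangle)=\{\epsilon\}$; $\mathrm{Pos}(\langle\Delta;[(\alpha_1,\mathtt{S}_1),\dots,(\alpha_n,\mathtt{S}_n)]\rangle)=\{\epsilon\}\cup\bigcup_{i=1}^n\{i\mathbf{k}\mid\mathbf{k}\in\mathrm{Pos}(\mathtt{S}_i)\}$. Subtree: $\mathtt{T}|_\epsilon=\mathtt{T}$, $\mathtt{T}|_{i\mathbf{r}}=\mathtt{S}_i|_{\mathbf{r}}$. Replacement: $\mathtt{T}[\mathtt{S}]_\epsilon=\mathtt{S}$,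 $\mathtt{T}[\mathtt{S}]_{i\mathbf{r}}$ is $\mathtt{T}$ with its $i$-th child $\mathtt{S}_i$ replaced by $\mathtt{S}_i[\mathtt{S}]_{\mathbf{r}}$ (same edge label). List operations, for $0<i,j\le|\Gamma|$: $\#_i\Gamma$ is the $i$-th element; $\Gamma^{ -i}$ deletes it; $\Gamma^{+i}=(\#_i\Gamma)\frown\Gamma$; $\Gamma[x]_i$ replaces the $i$-th element by $x$; $\Gamma^{i\leftrightarrow j}$ swaps the $i$-th and $j$-th elements; similarly $\Delta^{ -n},\Delta^{+n}$. $\mathsf{TRC}$ rules: for a modal tree $\mathtt{T}$, $\mathbf{k}\in\mathrm{Pos}(\mathtt{T})$ with $\mathtt{T}|_\mathbf{k}=\langle\Delta;\Gamma\rangle$: ($\rho^+$) $\mathtt{T}\hookrightarrow\mathtt{T}[\langle\Delta^{+i};\Gamma\rangle]_\mathbf{k}$, $0<i\le|\Delta|$; ($\rho^-$) $\mathtt{T}\hookrightarrow\mathtt{T}[\langle\Delta^{ -i};\Gamma\rangle]_\mathbf{k}$; ($\sigma$) $\mathtt{T}\hookrightarrow\mathtt{T}[\langle\Delta;\Gamma^{i\leftrightarrow j}\rangle]_\mathbf{k}$, $i\neq j$; ($\pi^+$) $\mathtt{T}\hookrightarrow\mathtt{T}[\langle\Delta;\Gamma^{+i}\rangle]_\mathbf{k}$; ($\pi^-$) $\mathtt{T}\hookrightarrow\mathtt{T}[\langle\Delta;\Gamma^{ -i}\rangle]_\mathbf{k}$; ($\mathfrak{4}$) if $\#_i\Gamma=(\beta,\langle\tilde\Delta;\tilde\Gamma\rangle)$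 and $\#_j\tilde\Gamma=(\beta,\mathtt{S})$, then $\mathtt{T}\hookrightarrow\mathtt{T}[\langle\Delta;\Gamma[(\beta,\mathtt{S})]_i\rangle]_\mathbf{k}$; ($\lambda$) if $\#_i\Gamma=(\alpha,\mathtt{S})$ and $\alpha>\beta$, then $\mathtt{T}\hookrightarrow\mathtt{T}[\langle\Delta;\Gamma[(\beta,\mathtt{S})]_i\rangle]_\mathbf{k}$; ($\mathsf{J}$) if $i\ne j$, $\#_i\Gamma=(\alpha,\langle\tilde\Delta;\tilde\Gamma\rangle)$, $\#_j\Gamma=(\beta,\mathtt{S})$, $\alpha>\beta$, then $\mathtt{T}\hookrightarrow\mathtt{T}[\langle\Delta;(\Gamma[(\alpha,\langle\tilde\Delta;\tilde\Gamma\frown(\beta,\mathtt{S})\rangle)]_i)^{ -j}\rangle]_\mathbf{k}$. $\hookrightarrow$ is the union of these relations, $\hookrightarrow^*$ its reflexive-transitive closure. -}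

module Defs where

open import Data.Nat using (ℕ; _>_)
open import Data.List using (List; []; _∷_; _++_; length; map)
open import Data.Fin using (Fin; zero; suc)
open import Data.Product using (_×_; _,_)
open import Relation.Binary.PropositionalEquality using (_≡_; _≢_; refl; cong; subst; sym)
import Data.Nat as ℕ
open import Relation.Binary.Construct.Closure.ReflexiveTransitive using (Star)

-- Propositional variables are indexed by ℕ; modalities ⟨α⟩ with α < ω are ℕ.
Var : Set
Var = ℕ

data Formula : Set where
  ⊤'  : Formula
  var : Var → Formula
  ⟨_⟩_ : ℕ → Formula → Formula
  _∧'_ : Formula → Formula → Formula

infixr 6 _∧'_
infix 4 _⊢RC_

data _⊢RC_ : Formula → Formula → Set where
  ax-refl : ∀ {φ} → φ ⊢RC φ
  ax-top  : ∀ {φ} → φ ⊢RC ⊤'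
  ax-∧l   : ∀ {φ ψ} → (φ ∧' ψ) ⊢RC φ
  ax-∧r   : ∀ {φ ψ} → (φ ∧' ψ) ⊢RC ψ
  r-trans : ∀ {φ ψ χ} → φ ⊢RC ψ → ψ ⊢RC χ → φ ⊢RC χ
  r-∧     : ∀ {φ ψ χ} → φ ⊢RC ψ → φ ⊢RC χ → φ ⊢RC (ψ ∧' χ)
  r-nec   : ∀ {φ ψ} α → φ ⊢RC ψ → (⟨ α ⟩ φ) ⊢RC (⟨ α ⟩ ψ)
  ax-4    : ∀ {φ} α → (⟨ α ⟩ ⟨ α ⟩ φ) ⊢RC (⟨ α ⟩ φ)
  ax-mono : ∀ {φ} α β → α > β → (⟨ α ⟩ φ) ⊢RC (⟨ β ⟩ φ)
  ax-J    : ∀ {φ ψ} α β → α > β →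
            ((⟨ α ⟩ φ) ∧' (⟨ β ⟩ ψ)) ⊢RC (⟨ α ⟩ (φ ∧' (⟨ β ⟩ ψ)))

data Tree : Set where
  node : List Var → List (ℕ × Tree) → Tree

_⊕_ : Tree → Tree → Tree
node Δ₁ Γ₁ ⊕ node Δ₂ Γ₂ = node (Δ₁ ++ Δ₂) (Γ₁ ++ Γ₂)

𝒯 : Formula → Tree
𝒯 ⊤' = node [] []
𝒯 (var p) = node (p ∷ []) []
𝒯 (⟨ α ⟩ φ) = node [] ((α , 𝒯 φ) ∷ [])
𝒯 (φ ∧' ψ) = 𝒯 φ ⊕ 𝒯 ψ

⋀ : List Formula → Formula
⋀ [] = ⊤'
⋀ (φ ∷ Π) = φ ∧' ⋀ Π

mutual
  ℱ : Tree → Formula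
  ℱ (node Δ Γ) = ⋀ (map var Δ) ∧' ⋀ (ℱs Γ)

  -- [⟨α⟩ ℱ(S) | (α,S) ∈ Γ], written structurally for termination
  ℱs : List (ℕ × Tree) → List Formula
  ℱs [] = []
  ℱs ((α , S) ∷ Γ) = (⟨ α ⟩ ℱ S) ∷ ℱs Γ

-- List operations (indices 0 < i ≤ |Γ| are represented by Fin (length Γ))
module _ {A : Set} where
  nth : (xs : List A) → Fin (length xs) → A
  nth (x ∷ xs) zero = x
  nth (x ∷ xs) (suc i) = nth xs i

  del : (xs : List A) → Fin (length xs) → List A
  del (x ∷ xs) zero = xs
  del (x ∷ xs) (suc i) = x ∷ del xs i

  dup : (xs : List A) → Fin (length xs) → List A
  dup xs i = nth xs i ∷ xs

  upd : (xs : List A) → Fin (length xs) → A → List A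
  upd (x ∷ xs) zero y = y ∷ xs
  upd (x ∷ xs) (suc i) y = x ∷ upd xs i y

  len-upd : ∀ (ys : List A) k y → length (upd ys k y) ≡ length ys
  len-upd (_ ∷ ys) zero y = refl
  len-upd (_ ∷ ys) (suc k) y = cong ℕ.suc (len-upd ys k y)

  idx-upd : ∀ (ys : List A) k y → Fin (length ys) → Fin (length (upd ys k y))
  idx-upd ys k y j = subst Fin (sym (len-upd ys k y)) j

  swap : (xs : List A) → Fin (length xs) → Fin (length xs) → List A
  swap xs i j = upd (upd xs i (nth xs j)) (idx-upd xs i (nth xs j) j) (nth xs i)

data RootStep : Tree → Tree → Set where
  ρ⁺ : ∀ {Δ Γ} (i : Fin (length Δ)) → RootStep (node Δ Γ) (node (dup Δ i) Γ)
  ρ⁻ : ∀ {Δ Γ} (i : Fin (length Δ)) → RootStep (node Δ Γ) (node (del Δ i) Γ)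
  σ  : ∀ {Δ Γ} (i j : Fin (length Γ)) → i ≢ j →
       RootStep (node Δ Γ) (node Δ (swap Γ i j))
  π⁺ : ∀ {Δ Γ} (i : Fin (length Γ)) → RootStep (node Δ Γ) (node Δ (dup Γ i))
  π⁻ : ∀ {Δ Γ} (i : Fin (length Γ)) → RootStep (node Δ Γ) (node Δ (del Γ i))
  𝔣𝔬𝔲𝔯 : ∀ {Δ Γ} (i : Fin (length Γ)) {β Δ̃ Γ̃} →
       nth Γ i ≡ (β , node Δ̃ Γ̃) →
       (j : Fin (length Γ̃)) {S : Tree} → nth Γ̃ j ≡ (β , S) →
       RootStep (node Δ Γ) (node Δ (upd Γ i (β , S)))
  λ' : ∀ {Δ Γ} (i : Fin (length Γ)) {α β S} → nth Γ i ≡ (α , S) → α > β →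
       RootStep (node Δ Γ) (node Δ (upd Γ i (β , S)))
  𝖩  : ∀ {Δ Γ} (i j : Fin (length Γ)) → i ≢ j → ∀ {α β Δ̃ Γ̃ S} →
       nth Γ i ≡ (α , node Δ̃ Γ̃) → nth Γ j ≡ (β , S) → α > β →
       let y = (α , node Δ̃ (Γ̃ ++ ((β , S) ∷ []))) in
       RootStep (node Δ Γ) (node Δ (del (upd Γ i y) (idx-upd Γ i y j)))

-- T ↪ T': a root step at some position k ∈ Pos(T), i.e. T[·]_k congruence
data _↪_ : Tree → Tree → Set where
  here  : ∀ {T T'} → RootStep T T' → T ↪ T'
  child : ∀ {Δ Γ} (i : Fin (length Γ)) {α S S'} → nth Γ i ≡ (α , S) → S ↪ S' →
          node Δ Γ ↪ node Δ (upd Γ i (α , S'))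

_↪*_ : Tree → Tree → Set
_↪*_ = Star _↪_

-- Soundness: under ℱ every TRC rule is an instance of an RC axiom or rule,
-- and φ is RC-equivalent to ℱ (𝒯 φ).
-- Completeness: by induction on RC-derivations, φ ⊢ ψ gives 𝒯 φ ⊕ T ↪* 𝒯 ψ ⊕ T
-- for every context tree T. The context is what makes the conjunction rule go
-- through: 𝒯 φ is duplicated and each copy is rewritten while the other waits in
-- the context. With the context on the right, the modal axioms become single
-- TRC steps on the first child. Finally T ↪* 𝒯 (ℱ T) ↪* T transfers this to arbitrary trees.
module Submission where

open import Defs
open import Data.Product using (_×_; _,_; ∃; map₂)
open import Data.Sum using ([_,_]′)
open import Data.Nat using (ℕ; _>_)
open import Data.Fin using (Fin; zero; suc)
open import Data.List using (List; []; _∷_; _++_; _∷ʳ_; length; map)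
open import Data.List.Properties using (++-identityʳ; ++-assoc)
open import Data.List.Relation.Unary.Any using (here; there)
open import Data.List.Membership.Propositional using (_∈_)
open import Data.List.Membership.Propositional.Properties using (∈-++⁻)
open import Data.List.Relation.Binary.Subset.Propositional using (_⊆_)
open import Data.List.Relation.Binary.Subset.Propositional.Properties
  using (⊆-refl; ⊆-trans; xs⊆x∷xs; ∈-∷⁺ʳ; xs⊆xs++ys; xs⊆ys++xs)
open import Data.List.Relation.Binary.Pointwise using (Pointwise; []; _∷_)
import Data.Product.Relation.Binary.Pointwise.NonDependent as ×
open import Function using (_∘_)
open import Relation.Binary.PropositionalEquality using (_≡_; refl; sym; cong; cong₂; subst; subst₂)
open import Relation.Binary.Construct.Closure.ReflexiveTransitive using (Star; ε; _◅_; _◅◅_)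

module _ {A : Set} where

  nth∈ : ∀ (xs : List A) i → nth xs i ∈ xs
  nth∈ (x ∷ xs) zero = here refl
  nth∈ (x ∷ xs) (suc i) = there (nth∈ xs i)

  ∈⇒nth : ∀ {x} {xs : List A} → x ∈ xs → ∃ λ i → nth xs i ≡ x
  ∈⇒nth (here refl) = zero , refl
  ∈⇒nth (there x∈xs) with i , eq ← ∈⇒nth x∈xs = suc i , eq

  dup⊆ : ∀ (xs : List A) i → dup xs i ⊆ xs
  dup⊆ xs i = ∈-∷⁺ʳ (nth∈ xs i) ⊆-refl

  del⊆ : ∀ (xs : List A) i → del xs i ⊆ xs
  del⊆ (x ∷ xs) zero = there
  del⊆ (x ∷ xs) (suc i) (here refl) = here refl
  del⊆ (x ∷ xs) (suc i) (there p) = there (del⊆ xs i p)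

  upd⊆ : ∀ (xs : List A) i y → upd xs i y ⊆ y ∷ xs
  upd⊆ (x ∷ xs) zero y (here refl) = here refl
  upd⊆ (x ∷ xs) zero y (there p) = there (there p)
  upd⊆ (x ∷ xs) (suc i) y (here refl) = there (here refl)
  upd⊆ (x ∷ xs) (suc i) y (there p) = ∈-∷⁺ʳ (here refl) (there ∘ there) (upd⊆ xs i y p)

  upd-nth⊆ : ∀ (xs : List A) i j → upd xs i (nth xs j) ⊆ xs
  upd-nth⊆ xs i j = ⊆-trans (upd⊆ xs i (nth xs j)) (∈-∷⁺ʳ (nth∈ xs j) ⊆-refl)

  swap⊆ : ∀ (xs : List A) i j → swap xs i j ⊆ xs
  swap⊆ xs i j =
    ⊆-trans (upd⊆ _ _ (nth xs i)) (∈-∷⁺ʳ (nth∈ xs i) (upd-nth⊆ xs i j))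

  ++-⊆ : ∀ {xs ys zs : List A} → xs ⊆ zs → ys ⊆ zs → xs ++ ys ⊆ zs
  ++-⊆ {xs} xs⊆zs ys⊆zs = [ xs⊆zs , ys⊆zs ]′ ∘ ∈-++⁻ xs

  middle : ∀ (pre : List A) x post → Fin (length (pre ++ x ∷ post))
  middle [] x post = zero
  middle (_ ∷ pre) x post = suc (middle pre x post)

  nth-middle : ∀ pre x post → nth (pre ++ x ∷ post) (middle pre x post) ≡ x
  nth-middle [] x post = refl
  nth-middle (_ ∷ pre) x post = nth-middle pre x post

  upd-middle : ∀ pre x post y → upd (pre ++ x ∷ post) (middle pre x post) y ≡ pre ++ y ∷ post
  upd-middle [] x post y = refl
  upd-middle (p ∷ pre) x post y = cong (p ∷_) (upd-middle pre x post y)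

  del-middle : ∀ pre x post → del (pre ++ x ∷ post) (middle pre x post) ≡ pre ++ post
  del-middle [] x post = refl
  del-middle (p ∷ pre) x post = cong (p ∷_) (del-middle pre x post)

module _ {A I : Set} {_⟶_ : I → I → Set} (f : List A → I)
         (dup-step : ∀ xs i → f xs ⟶ f (dup xs i))
         (del-step : ∀ xs i → f xs ⟶ f (del xs i)) where

  dup-step-∈ : ∀ {x xs} → x ∈ xs → f xs ⟶ f (x ∷ xs)
  dup-step-∈ {xs = xs} x∈xs with i , refl ← ∈⇒nth x∈xs = dup-step xs i

  prepend-⊆ : ∀ {xs} ys → ys ⊆ xs → Star _⟶_ (f xs) (f (ys ++ xs))
  prepend-⊆ [] _ = ε
  prepend-⊆ {xs} (y ∷ ys) y∷ys⊆xs =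
    prepend-⊆ ys (y∷ys⊆xs ∘ there)
    ◅◅ dup-step-∈ (xs⊆ys++xs xs ys (y∷ys⊆xs (here refl))) ◅ ε

  drop-suffix : ∀ ys xs → Star _⟶_ (f (ys ++ xs)) (f ys)
  drop-suffix ys [] rewrite ++-identityʳ ys = ε
  drop-suffix ys (x ∷ xs) =
    subst (λ zs → f (ys ++ x ∷ xs) ⟶ f zs) (del-middle ys x xs) (del-step _ (middle ys x xs))
    ◅ drop-suffix ys xs

  ⊆⇒Star : ∀ {xs ys} → ys ⊆ xs → Star _⟶_ (f xs) (f ys)
  ⊆⇒Star {xs} {ys} ys⊆xs = prepend-⊆ ys ys⊆xs ◅◅ drop-suffix ys xs

vars : Tree → List Var
vars (node Δ Γ) = Δ

children : Tree → List (ℕ × Tree)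
children (node Δ Γ) = Γ

infix 4 _⊑_

record _⊑_ (A B : Tree) : Set where
  constructor mk⊑
  field
    vars⊆ : vars A ⊆ vars B
    children⊆ : children A ⊆ children B

⊑-refl : ∀ {A} → A ⊑ A
⊑-refl = mk⊑ ⊆-refl ⊆-refl

⊑-trans : ∀ {A B C} → A ⊑ B → B ⊑ C → A ⊑ C
⊑-trans (mk⊑ v₁ c₁) (mk⊑ v₂ c₂) = mk⊑ (⊆-trans v₁ v₂) (⊆-trans c₁ c₂)

⊑-⊕ˡ : ∀ {A B} → A ⊑ A ⊕ B
⊑-⊕ˡ {node Δ₁ Γ₁} {node Δ₂ Γ₂} = mk⊑ (xs⊆xs++ys Δ₁ Δ₂) (xs⊆xs++ys Γ₁ Γ₂)

⊑-⊕ʳ : ∀ {A B} → B ⊑ A ⊕ B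
⊑-⊕ʳ {node Δ₁ Γ₁} {node Δ₂ Γ₂} = mk⊑ (xs⊆ys++xs Δ₂ Δ₁) (xs⊆ys++xs Γ₂ Γ₁)

⊕-⊑ : ∀ {A B C} → A ⊑ C → B ⊑ C → A ⊕ B ⊑ C
⊕-⊑ {node _ _} {node _ _} (mk⊑ v₁ c₁) (mk⊑ v₂ c₂) = mk⊑ (++-⊆ v₁ v₂) (++-⊆ c₁ c₂)

⊕-monoˡ-⊑ : ∀ {A A' T} → A ⊑ A' → A ⊕ T ⊑ A' ⊕ T
⊕-monoˡ-⊑ A⊑A' = ⊕-⊑ (⊑-trans A⊑A' ⊑-⊕ˡ) ⊑-⊕ʳ

⊕-idem-⊑ : ∀ {A T} → A ⊕ (A ⊕ T) ⊑ A ⊕ T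
⊕-idem-⊑ = ⊕-⊑ ⊑-⊕ˡ ⊑-refl

⊕-exchange-⊑ : ∀ {A B T} → A ⊕ (B ⊕ T) ⊑ B ⊕ (A ⊕ T)
⊕-exchange-⊑ = ⊕-⊑ (⊑-trans ⊑-⊕ˡ ⊑-⊕ʳ) (⊕-⊑ ⊑-⊕ˡ (⊑-trans ⊑-⊕ʳ ⊑-⊕ʳ))

⊕-assoc : ∀ A B C → (A ⊕ B) ⊕ C ≡ A ⊕ (B ⊕ C)
⊕-assoc (node Δ₁ Γ₁) (node Δ₂ Γ₂) (node Δ₃ Γ₃) =
  cong₂ node (++-assoc Δ₁ Δ₂ Δ₃) (++-assoc Γ₁ Γ₂ Γ₃)

⊕-identityʳ : ∀ A → A ⊕ node [] [] ≡ A
⊕-identityʳ (node Δ Γ) = cong₂ node (++-identityʳ Δ) (++-identityʳ Γ)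

◇ℱ : ℕ × Tree → Formula
◇ℱ (α , S) = ⟨ α ⟩ ℱ S

ℱs-map : ∀ Γ → ℱs Γ ≡ map ◇ℱ Γ
ℱs-map [] = refl
ℱs-map ((α , S) ∷ Γ) = cong (⟨ α ⟩ ℱ S ∷_) (ℱs-map Γ)

module _ {B : Set} (f : B → Formula) where

  ⋀-map-elim : ∀ {x xs} → x ∈ xs → ⋀ (map f xs) ⊢RC f x
  ⋀-map-elim (here refl) = ax-∧l
  ⋀-map-elim (there x∈xs) = r-trans ax-∧r (⋀-map-elim x∈xs)

  ⋀-map-intro : ∀ {φ} xs → (∀ {x} → x ∈ xs → φ ⊢RC f x) → φ ⊢RC ⋀ (map f xs)
  ⋀-map-intro [] _ = ax-top
  ⋀-map-intro (x ∷ xs) φ⊢f = r-∧ (φ⊢f (here refl)) (⋀-map-intro xs (φ⊢f ∘ there))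

ℱ-var : ∀ {p Δ Γ} → p ∈ Δ → ℱ (node Δ Γ) ⊢RC var p
ℱ-var p∈Δ = r-trans ax-∧l (⋀-map-elim var p∈Δ)

ℱ-child : ∀ {α S Δ Γ} → (α , S) ∈ Γ → ℱ (node Δ Γ) ⊢RC ⟨ α ⟩ ℱ S
ℱ-child {Γ = Γ} αS∈Γ rewrite ℱs-map Γ = r-trans ax-∧r (⋀-map-elim ◇ℱ αS∈Γ)

ℱ-intro : ∀ {φ Δ Γ} → (∀ {p} → p ∈ Δ → φ ⊢RC var p) →
          (∀ {α S} → (α , S) ∈ Γ → φ ⊢RC ⟨ α ⟩ ℱ S) → φ ⊢RC ℱ (node Δ Γ)
ℱ-intro {Δ = Δ} {Γ} φ⊢vars φ⊢children rewrite ℱs-map Γ =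
  r-∧ (⋀-map-intro var Δ φ⊢vars) (⋀-map-intro ◇ℱ Γ φ⊢children)

ℱ-cons : ∀ {φ α S Δ Γ} → φ ⊢RC ℱ (node Δ Γ) → φ ⊢RC ⟨ α ⟩ ℱ S →
         φ ⊢RC ℱ (node Δ ((α , S) ∷ Γ))
ℱ-cons φ⊢T φ⊢αS = r-∧ (r-trans φ⊢T ax-∧l) (r-∧ φ⊢αS (r-trans φ⊢T ax-∧r))

⊑⇒⊢ : ∀ {A B} → A ⊑ B → ℱ B ⊢RC ℱ A
⊑⇒⊢ {node _ _} {node _ _} (mk⊑ vars⊆ children⊆) =
  ℱ-intro (ℱ-var ∘ vars⊆) (ℱ-child ∘ children⊆)

ℱ-⊕ : ∀ A B → ℱ A ∧' ℱ B ⊢RC ℱ (A ⊕ B)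
ℱ-⊕ (node Δ₁ Γ₁) (node Δ₂ Γ₂) =
  ℱ-intro (λ p∈ → [ (λ p∈Δ₁ → r-trans ax-∧l (ℱ-var p∈Δ₁))
                  , (λ p∈Δ₂ → r-trans ax-∧r (ℱ-var p∈Δ₂)) ]′ (∈-++⁻ Δ₁ p∈))
          (λ αS∈ → [ (λ αS∈Γ₁ → r-trans ax-∧l (ℱ-child αS∈Γ₁))
                   , (λ αS∈Γ₂ → r-trans ax-∧r (ℱ-child αS∈Γ₂)) ]′ (∈-++⁻ Γ₁ αS∈))

ℱ-upd : ∀ {Δ Γ β S} i → ℱ (node Δ Γ) ⊢RC ⟨ β ⟩ ℱ S →
        ℱ (node Δ Γ) ⊢RC ℱ (node Δ (upd Γ i (β , S)))
ℱ-upd {Γ = Γ} i ⊢βS = r-trans (ℱ-cons ax-refl ⊢βS) (⊑⇒⊢ (mk⊑ ⊆-refl (upd⊆ Γ i _)))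

ℱ-nth : ∀ {Δ Γ α S} i → nth Γ i ≡ (α , S) → ℱ (node Δ Γ) ⊢RC ⟨ α ⟩ ℱ S
ℱ-nth {Γ = Γ} i refl = ℱ-child (nth∈ Γ i)

rootStep-sound : ∀ {T T'} → RootStep T T' → ℱ T ⊢RC ℱ T'
rootStep-sound (ρ⁺ {Δ} i) = ⊑⇒⊢ (mk⊑ (dup⊆ Δ i) ⊆-refl)
rootStep-sound (ρ⁻ {Δ} i) = ⊑⇒⊢ (mk⊑ (del⊆ Δ i) ⊆-refl)
rootStep-sound (σ {Γ = Γ} i j _) = ⊑⇒⊢ (mk⊑ ⊆-refl (swap⊆ Γ i j))
rootStep-sound (π⁺ {Γ = Γ} i) = ⊑⇒⊢ (mk⊑ ⊆-refl (dup⊆ Γ i))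
rootStep-sound (π⁻ {Γ = Γ} i) = ⊑⇒⊢ (mk⊑ ⊆-refl (del⊆ Γ i))
rootStep-sound (𝔣𝔬𝔲𝔯 i eq j eq') =
  ℱ-upd i (r-trans (ℱ-nth i eq) (r-trans (r-nec _ (ℱ-nth j eq')) (ax-4 _)))
rootStep-sound (λ' i eq α>β) = ℱ-upd i (r-trans (ℱ-nth i eq) (ax-mono _ _ α>β))
rootStep-sound (𝖩 {Δ} {Γ} i j _ {α} {β} {Δ̃} {Γ̃} {S} eq eq' α>β) =
  r-trans (ℱ-cons ax-refl ⊢αS̃)
          (⊑⇒⊢ (mk⊑ ⊆-refl (⊆-trans (del⊆ (upd Γ i y) _) (upd⊆ Γ i y))))
  where
  y = (α , node Δ̃ (Γ̃ ∷ʳ (β , S)))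
  ∷ʳ⊆∷ : Γ̃ ∷ʳ (β , S) ⊆ (β , S) ∷ Γ̃
  ∷ʳ⊆∷ = ++-⊆ (xs⊆x∷xs Γ̃ _) (∈-∷⁺ʳ (here refl) λ ())
  ⊢αS̃ : ℱ (node Δ Γ) ⊢RC ⟨ α ⟩ ℱ (node Δ̃ (Γ̃ ∷ʳ (β , S)))
  ⊢αS̃ = r-trans (r-∧ (ℱ-nth i eq) (ℱ-nth j eq'))
        (r-trans (ax-J α β α>β)
        (r-nec α (r-trans (ℱ-cons ax-∧l ax-∧r) (⊑⇒⊢ (mk⊑ ⊆-refl ∷ʳ⊆∷)))))

↪-sound : ∀ {T T'} → T ↪ T' → ℱ T ⊢RC ℱ T'
↪-sound (here step) = rootStep-sound step
↪-sound (child i eq S↪S') = ℱ-upd i (r-trans (ℱ-nth i eq) (r-nec _ (↪-sound S↪S')))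

↪*-sound : ∀ {T T'} → T ↪* T' → ℱ T ⊢RC ℱ T'
↪*-sound ε = ax-refl
↪*-sound (step ◅ steps) = r-trans (↪-sound step) (↪*-sound steps)

φ⊢ℱ𝒯φ : ∀ φ → φ ⊢RC ℱ (𝒯 φ)
φ⊢ℱ𝒯φ ⊤' = ℱ-intro (λ ()) (λ ())
φ⊢ℱ𝒯φ (var p) = ℱ-intro (λ { (here refl) → ax-refl }) (λ ())
φ⊢ℱ𝒯φ (⟨ α ⟩ φ) = ℱ-cons (ℱ-intro (λ ()) (λ ())) (r-nec α (φ⊢ℱ𝒯φ φ))
φ⊢ℱ𝒯φ (φ ∧' ψ) =
  r-trans (r-∧ (r-trans ax-∧l (φ⊢ℱ𝒯φ φ)) (r-trans ax-∧r (φ⊢ℱ𝒯φ ψ))) (ℱ-⊕ (𝒯 φ) (𝒯 ψ))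

ℱ𝒯φ⊢φ : ∀ φ → ℱ (𝒯 φ) ⊢RC φ
ℱ𝒯φ⊢φ ⊤' = ax-top
ℱ𝒯φ⊢φ (var p) = ℱ-var (here refl)
ℱ𝒯φ⊢φ (⟨ α ⟩ φ) = r-trans (ℱ-child (here refl)) (r-nec α (ℱ𝒯φ⊢φ φ))
ℱ𝒯φ⊢φ (φ ∧' ψ) =
  r-∧ (r-trans (⊑⇒⊢ ⊑-⊕ˡ) (ℱ𝒯φ⊢φ φ))
      (r-trans (⊑⇒⊢ ⊑-⊕ʳ) (ℱ𝒯φ⊢φ ψ))

≡⇒↪* : ∀ {T T'} → T ≡ T' → T ↪* T'
≡⇒↪* refl = ε

⊑⇒↪* : ∀ {A B} → A ⊑ B → B ↪* A
⊑⇒↪* {node Δ' Γ'} {node Δ Γ} (mk⊑ Δ'⊆Δ Γ'⊆Γ) =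
  ⊆⇒Star (λ Δ → node Δ Γ) (λ _ i → here (ρ⁺ i)) (λ _ i → here (ρ⁻ i)) Δ'⊆Δ
  ◅◅ ⊆⇒Star (node Δ') (λ _ i → here (π⁺ i)) (λ _ i → here (π⁻ i)) Γ'⊆Γ

↪*-at : ∀ {Δ α S S'} pre post → S ↪* S' →
        node Δ (pre ++ (α , S) ∷ post) ↪* node Δ (pre ++ (α , S') ∷ post)
↪*-at pre post ε = ε
↪*-at {Δ} {α} {S} pre post (_◅_ {j = S₁} step steps) =
  subst (node Δ (pre ++ (α , S) ∷ post) ↪_)
        (cong (node Δ) (upd-middle pre (α , S) post (α , S₁)))
        (child (middle pre (α , S) post) (nth-middle pre (α , S) post) step)
  ◅ ↪*-at pre post steps

↪*-children : ∀ {Δ Γ Γ'} → Pointwise (×.Pointwise _≡_ _↪*_) Γ Γ' → node Δ Γ ↪* node Δ Γ'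
↪*-children = from-prefix []
  where
  from-prefix : ∀ {Δ Γ Γ'} pre → Pointwise (×.Pointwise _≡_ _↪*_) Γ Γ' →
                node Δ (pre ++ Γ) ↪* node Δ (pre ++ Γ')
  from-prefix pre [] = ε
  from-prefix {Δ} {(α , S) ∷ Γ} {(α , S') ∷ Γ'} pre ((refl , S↪*S') ∷ Γ↪*Γ') =
    ↪*-at pre Γ S↪*S'
    ◅◅ ≡⇒↪* (cong (node Δ) (sym (++-assoc pre _ Γ)))
    ◅◅ from-prefix (pre ∷ʳ (α , S')) Γ↪*Γ'
    ◅◅ ≡⇒↪* (cong (node Δ) (++-assoc pre _ Γ'))

J-head : ∀ {Δ Γ α β} A B → α > β →
         node Δ ((α , A) ∷ (β , B) ∷ Γ) ↪ node Δ ((α , A ⊕ node [] ((β , B) ∷ [])) ∷ Γ)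
J-head (node Δ̃ Γ̃) B α>β rewrite ++-identityʳ Δ̃ =
  here (𝖩 zero (suc zero) (λ ()) refl refl α>β)

mutual
  ⊢⇒↪* : ∀ {φ ψ} → φ ⊢RC ψ → 𝒯 φ ↪* 𝒯 ψ
  ⊢⇒↪* {φ} {ψ} φ⊢ψ =
    subst₂ _↪*_ (⊕-identityʳ (𝒯 φ)) (⊕-identityʳ (𝒯 ψ)) (⊢⇒↪*-⊕ φ⊢ψ (node [] []))

  ⊢⇒↪*-⊕ : ∀ {φ ψ} → φ ⊢RC ψ → ∀ T → (𝒯 φ ⊕ T) ↪* (𝒯 ψ ⊕ T)
  ⊢⇒↪*-⊕ ax-refl T = ε
  ⊢⇒↪*-⊕ ax-top (node Δ Γ) = ⊑⇒↪* ⊑-⊕ʳ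
  ⊢⇒↪*-⊕ ax-∧l T = ⊑⇒↪* (⊕-monoˡ-⊑ ⊑-⊕ˡ)
  ⊢⇒↪*-⊕ ax-∧r T = ⊑⇒↪* (⊕-monoˡ-⊑ ⊑-⊕ʳ)
  ⊢⇒↪*-⊕ (r-trans φ⊢ψ ψ⊢χ) T = ⊢⇒↪*-⊕ φ⊢ψ T ◅◅ ⊢⇒↪*-⊕ ψ⊢χ T
  ⊢⇒↪*-⊕ (r-∧ {φ} {ψ} {χ} φ⊢ψ φ⊢χ) T =
    ⊑⇒↪* ⊕-idem-⊑
    ◅◅ ⊢⇒↪*-⊕ φ⊢χ (𝒯 φ ⊕ T)
    ◅◅ ⊑⇒↪* ⊕-exchange-⊑
    ◅◅ ⊢⇒↪*-⊕ φ⊢ψ (𝒯 χ ⊕ T)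
    ◅◅ ≡⇒↪* (sym (⊕-assoc (𝒯 ψ) (𝒯 χ) T))
  ⊢⇒↪*-⊕ (r-nec α φ⊢ψ) (node Δ Γ) = ↪*-at [] Γ (⊢⇒↪* φ⊢ψ)
  ⊢⇒↪*-⊕ (ax-4 α) (node Δ Γ) = here (𝔣𝔬𝔲𝔯 zero refl zero refl) ◅ ε
  ⊢⇒↪*-⊕ (ax-mono α β α>β) (node Δ Γ) = here (λ' zero refl α>β) ◅ ε
  ⊢⇒↪*-⊕ (ax-J {φ} {ψ} α β α>β) (node Δ Γ) = J-head (𝒯 φ) (𝒯 ψ) α>β ◅ ε

𝒯ℱs : List (ℕ × Tree) → List (ℕ × Tree)
𝒯ℱs = map (map₂ (𝒯 ∘ ℱ))

𝒯-⋀-vars : ∀ Δ → 𝒯 (⋀ (map var Δ)) ≡ node Δ []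
𝒯-⋀-vars [] = refl
𝒯-⋀-vars (p ∷ Δ) = cong (node (p ∷ []) [] ⊕_) (𝒯-⋀-vars Δ)

𝒯-⋀-ℱs : ∀ Γ → 𝒯 (⋀ (ℱs Γ)) ≡ node [] (𝒯ℱs Γ)
𝒯-⋀-ℱs [] = refl
𝒯-⋀-ℱs ((α , S) ∷ Γ) = cong (node [] ((α , 𝒯 (ℱ S)) ∷ []) ⊕_) (𝒯-⋀-ℱs Γ)

𝒯ℱ-node : ∀ Δ Γ → 𝒯 (ℱ (node Δ Γ)) ≡ node Δ (𝒯ℱs Γ)
𝒯ℱ-node Δ Γ rewrite 𝒯-⋀-vars Δ | 𝒯-⋀-ℱs Γ | ++-identityʳ Δ = refl

mutual
  ↪*-𝒯ℱ : ∀ T → T ↪* 𝒯 (ℱ T)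
  ↪*-𝒯ℱ (node Δ Γ) = ↪*-children (↪*-𝒯ℱs Γ) ◅◅ ≡⇒↪* (sym (𝒯ℱ-node Δ Γ))

  ↪*-𝒯ℱs : ∀ Γ → Pointwise (×.Pointwise _≡_ _↪*_) Γ (𝒯ℱs Γ)
  ↪*-𝒯ℱs [] = []
  ↪*-𝒯ℱs ((α , S) ∷ Γ) = (refl , ↪*-𝒯ℱ S) ∷ ↪*-𝒯ℱs Γ

mutual
  𝒯ℱ-↪* : ∀ T → 𝒯 (ℱ T) ↪* T
  𝒯ℱ-↪* (node Δ Γ) = ≡⇒↪* (𝒯ℱ-node Δ Γ) ◅◅ ↪*-children (𝒯ℱs-↪* Γ)

  𝒯ℱs-↪* : ∀ Γ → Pointwise (×.Pointwise _≡_ _↪*_) (𝒯ℱs Γ) Γ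
  𝒯ℱs-↪* [] = []
  𝒯ℱs-↪* ((α , S) ∷ Γ) = (refl , 𝒯ℱ-↪* S) ∷ 𝒯ℱs-↪* Γ

mainTheorem9 : (∀ (φ ψ : Formula) → 𝒯 φ ↪* 𝒯 ψ → φ ⊢RC ψ)
    × (∀ (T T' : Tree) → ℱ T ⊢RC ℱ T' → T ↪* T')
mainTheorem9 = sound , complete
  where
  sound : ∀ φ ψ → 𝒯 φ ↪* 𝒯 ψ → φ ⊢RC ψ
  sound φ ψ 𝒯φ↪*𝒯ψ = r-trans (φ⊢ℱ𝒯φ φ) (r-trans (↪*-sound 𝒯φ↪*𝒯ψ) (ℱ𝒯φ⊢φ ψ))

  complete : ∀ T T' → ℱ T ⊢RC ℱ T' → T ↪* T'
  complete T T' ℱT⊢ℱT' = ↪*-𝒯ℱ T ◅◅ ⊢⇒↪* ℱT⊢ℱT' ◅◅ 𝒯ℱ-↪* T'
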